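{- Let $b\ge2$, $B=\{0,1,\dots,b-1\}$, and let $\phi:B\to\mathbb{Z}_{\ge0}$ be any map. Suppose there is a positive integer $a$ with $a\mid b-1$ and $\phi(n)\equiv n\pmod a$ for all $n\in B$. Then $S_{\phi,b}(n)\equiv n\pmod a$ for all $n\in\mathbb{Z}_{\ge0}$. In particular, the cycles associated with the orbits of $n=1,\dots,a$ under $S_{\phi,b}$ are pairwise distinct, so $S_{\phi,b}$ has at least $a$ distinct cycles.
   Context: $S_{\phi,b}(n)=\phi(x_0)+\dots+\phi(x_d)$ where $n=x_0+x_1b+\dots+x_db^d$ is the base-$b$ expansion of $n\ge0$. The orbit of $n$ is $n,S_{\phi,b}(n),S_{\phi,b}(S_{\phi,b}(n)),\dots$; when finite, it eventually enters a cycle, i.e. a sequence of pairwise distinct integers $\mathrm{cyc}(n_1,\dots,n_\ell)$ with $S_{\phi,b}(n_i)=n_{i+1}$ ($1\le i<\ell$) and $S_{\phi,b}(n_\ell)=n_1$, unique up to cyclic permutation; this is the cycle associated with the orbit. -}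

module Defs where

open import Data.Nat using (ℕ; zero; suc; _+_; _<_; NonZero)
open import Data.Nat.Properties using (_<?_)
open import Data.Nat.DivMod using (_%_; _/_; m%n<n)
open import Data.Fin using (Fin; fromℕ<)
open import Data.List using (List; []; _∷_; _++_; [_]; map)
open import Data.Nat.ListAction using (sum)
open import Data.List.Relation.Unary.Unique.Propositional using (Unique)
open import Data.List.Membership.Propositional using (_∈_)
open import Data.Product using (Σ; ∃; _×_)
open import Data.Empty using (⊥)
open import Relation.Nullary using (yes; no)
open import Relation.Binary.PropositionalEquality using (_≡_)

-- Base-b digits (least significant first), each as an element of B = Fin b.
-- Fuel-driven; fuel (suc n) is always sufficient for n.
digitsFuel : (b : ℕ) .{{_ : NonZero b}} → ℕ → ℕ → List (Fin b)
digitsFuel b fuel n with n <? b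
... | yes n<b = [ fromℕ< n<b ]
digitsFuel b zero n | no _ = [ fromℕ< (m%n<n n b) ]
digitsFuel b (suc fuel) n | no _ = fromℕ< (m%n<n n b) ∷ digitsFuel b fuel (n / b)

-- base-b expansion x_0, ..., x_d of n (for n = 0 this is the single digit 0)
digits : (b : ℕ) .{{_ : NonZero b}} → ℕ → List (Fin b)
digits b n = digitsFuel b (suc n) n

S : (b : ℕ) .{{_ : NonZero b}} → (Fin b → ℕ) → ℕ → ℕ
S b φ n = sum (map φ (digits b n))

iter : (ℕ → ℕ) → ℕ → ℕ → ℕ
iter f zero n = n
iter f (suc k) n = iter f k (f n)

Path : (ℕ → ℕ) → ℕ → List ℕ → ℕ → Set
Path f y [] x0 = f y ≡ x0
Path f y (z ∷ zs) x0 = (f y ≡ z) × Path f z zs x0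

IsCycle : (ℕ → ℕ) → List ℕ → Set
IsCycle f [] = ⊥
IsCycle f (x ∷ xs) = Unique (x ∷ xs) × Path f x xs x

AssocCycle : (ℕ → ℕ) → ℕ → List ℕ → Set
AssocCycle f n c = IsCycle f c × ∃ λ k → iter f k n ∈ c

rotate : ℕ → List ℕ → List ℕ
rotate zero xs = xs
rotate (suc k) [] = []
rotate (suc k) (x ∷ xs) = rotate k (xs ++ [ x ])

SameCycle : List ℕ → List ℕ → Set
SameCycle c c' = ∃ λ k → rotate k c ≡ c'

-- Since b ≡ 1 (mod a), every power of b is ≡ 1 (mod a), so n = Σ xᵢ bⁱ ≡ Σ xᵢ ≡ Σ φ(xᵢ) = S(n)
-- (mod a): the residue mod a is constant along every orbit, hence on its cycle, and the
-- residues of 1, …, a are pairwise distinct.  Cycles exist because 2 S(n) ≤ n + D for a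
-- constant D (S(n) ≤ max φ + S(⌊n/b⌋), and ⌊n/b⌋ ≤ n/2), so every orbit is bounded and by
-- pigeonhole eventually periodic.
module Submission where

open import Defs
open import Data.Nat using (ℕ; zero; suc; _≤_; _<_; _∸_; NonZero; _+_; _*_; s≤s; >-nonZero)
open import Data.Nat.Properties
open import Data.Nat.DivMod
open import Data.Nat.Divisibility using (_∣_; divides)
open import Data.Nat.Induction using (<-rec)
open import Data.Nat.Tactic.RingSolver using (solve-∀)
open import Data.Nat.ListAction using (sum)
open import Data.Fin using (Fin; toℕ; fromℕ<)
open import Data.Fin.Properties using (toℕ-fromℕ<; fromℕ<-injective; pigeonhole)
open import Data.List using (List; []; _∷_; _++_; [_]; map; tabulate; applyUpTo)
open import Data.List.Extrema.Nat using (max; xs≤max)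
open import Data.List.Relation.Unary.All as All using (All; []; _∷_)
import Data.List.Relation.Unary.All.Properties as All
import Data.List.Relation.Unary.Unique.Propositional.Properties as Unique
open import Data.List.Relation.Unary.Any using (here; there)
open import Data.List.Membership.Propositional using (_∈_)
open import Data.List.Membership.Propositional.Properties using (∈-++⁻)
open import Data.Product using (∃; _×_; _,_; map₂)
open import Data.Sum using (inj₁; inj₂)
open import Function using (case_of_)
open import Relation.Nullary using (¬_; Dec; yes; no; contradiction)
open import Relation.Binary.PropositionalEquality using (_≡_; _≢_; refl; sym; trans; cong; cong₂; subst; module ≡-Reasoning)

module _ (f : ℕ → ℕ) where

  iter-+ : ∀ i j y → iter f (i + j) y ≡ iter f j (iter f i y)
  iter-+ zero    j y = refl
  iter-+ (suc i) j y = iter-+ i j (f y)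

  iter-≤ : ∀ {B} → (∀ {m} → m ≤ B → f m ≤ B) → ∀ k {n} → n ≤ B → iter f k n ≤ B
  iter-≤ f≤ zero    n≤B = n≤B
  iter-≤ f≤ (suc k) n≤B = iter-≤ f≤ k (f≤ n≤B)

  AssocCycle-iter : ∀ i {n c} → AssocCycle f (iter f i n) c → AssocCycle f n c
  AssocCycle-iter i {n} {c} (isCycle , k , fᵏ⁺ⁱn∈c) =
    isCycle , i + k , subst (_∈ c) (sym (iter-+ i k n)) fᵏ⁺ⁱn∈c

  repeat⇒periodic : ∀ {i j y} → i < j → iter f i y ≡ iter f j y →
                    iter f (j ∸ i) (iter f i y) ≡ iter f i y
  repeat⇒periodic {i} {j} {y} i<j fⁱy≡fʲy = begin
    iter f (j ∸ i) (iter f i y) ≡⟨ iter-+ i (j ∸ i) y ⟨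
    iter f (i + (j ∸ i)) y      ≡⟨ cong (λ k → iter f k y) (m+[n∸m]≡n (<⇒≤ i<j)) ⟩
    iter f j y                  ≡⟨ fⁱy≡fʲy ⟨
    iter f i y                  ∎
    where open ≡-Reasoning

  orbit : ℕ → ℕ → List ℕ
  orbit y k = applyUpTo (λ i → iter f i y) k

  Path-orbit : ∀ k y → Path f y (orbit (f y) k) (iter f (suc k) y)
  Path-orbit zero    y = refl
  Path-orbit (suc k) y = refl , Path-orbit k (f y)

  -- If the first T iterates of y repeat, a repeated point has a shorter period;
  -- otherwise they form the cycle through y.
  periodic⇒AssocCycle : ∀ T y → 0 < T → iter f T y ≡ y → ∃ (AssocCycle f y)
  periodic⇒AssocCycle = <-rec _ descend
    where
    Repeat : ℕ → ℕ → Set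
    Repeat T y = ∃ λ j → j < T × ∃ λ i → i < j × iter f i y ≡ iter f j y

    repeat? : ∀ T y → Dec (Repeat T y)
    repeat? T y = anyUpTo? (λ j → anyUpTo? (λ i → iter f i y ≟ iter f j y) j) T

    descend : ∀ T → (∀ {T′} → T′ < T → ∀ y → 0 < T′ → iter f T′ y ≡ y → ∃ (AssocCycle f y)) →
              ∀ y → 0 < T → iter f T y ≡ y → ∃ (AssocCycle f y)
    descend (suc t) shorter y _ fᵀy≡y with repeat? (suc t) y
    ... | yes (j , j<T , i , i<j , fⁱy≡fʲy) =
      map₂ (AssocCycle-iter i) (shorter (≤-<-trans (m∸n≤m j i) j<T) (iter f i y) (m<n⇒0<n∸m i<j)
                                        (repeat⇒periodic i<j fⁱy≡fʲy))
    ... | no noRepeat =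
      orbit y (suc t) ,
      (Unique.applyUpTo⁺₁ _ (suc t) (λ i<j j<T e → noRepeat (_ , j<T , _ , i<j , e)) ,
       subst (Path f y (orbit (f y) t)) fᵀy≡y (Path-orbit t y)) ,
      0 , here refl

  bounded⇒AssocCycle : ∀ B n → (∀ k → iter f k n ≤ B) → ∃ (AssocCycle f n)
  bounded⇒AssocCycle B n fᵏn≤B
    with i , j , i<j , eq ← pigeonhole (n<1+n (suc B)) (λ k → fromℕ< (s≤s (fᵏn≤B (toℕ k))))
    = map₂ (AssocCycle-iter (toℕ i))
           (periodic⇒AssocCycle (toℕ j ∸ toℕ i) (iter f (toℕ i) n) (m<n⇒0<n∸m i<j)
                                (repeat⇒periodic i<j (fromℕ<-injective _ _ _ _ eq)))

∈-rotate : ∀ {y} k xs → y ∈ rotate k xs → y ∈ xs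
∈-rotate zero    xs       y∈ = y∈
∈-rotate (suc k) []       y∈ = y∈
∈-rotate (suc k) (x ∷ xs) y∈ with ∈-++⁻ xs (∈-rotate k (xs ++ [ x ]) y∈)
... | inj₁ y∈xs       = there y∈xs
... | inj₂ (here y≡x) = here y≡x

module _ (f : ℕ → ℕ) (a : ℕ) .{{_ : NonZero a}} (f≡ : ∀ m → f m % a ≡ m % a) where

  iter-% : ∀ k m → iter f k m % a ≡ m % a
  iter-% zero    m = refl
  iter-% (suc k) m = trans (iter-% k (f m)) (f≡ m)

  Path-% : ∀ {y zs x} → Path f y zs x → All (λ z → z % a ≡ y % a) zs
  Path-% {zs = []}     _           = []
  Path-% {y} {z ∷ zs} (fy≡z , p) = z≡y ∷ All.map (λ w≡z → trans w≡z z≡y) (Path-% p)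
    where z≡y = trans (cong (_% a) (sym fy≡z)) (f≡ y)

  AssocCycle-% : ∀ {n c z} → AssocCycle f n c → z ∈ c → z % a ≡ n % a
  AssocCycle-% {n} {x ∷ xs} {z} ((_ , path) , k , fᵏn∈c) z∈c =
    trans (≡x z∈c) (trans (sym (≡x fᵏn∈c)) (iter-% k n))
    where
    ≡x : ∀ {w} → w ∈ x ∷ xs → w % a ≡ x % a
    ≡x (here refl) = refl
    ≡x (there w∈xs) = All.lookup (Path-% path) w∈xs

  SameCycle⇒%≡ : ∀ {i j c c′} → AssocCycle f i c → AssocCycle f j c′ → SameCycle c c′ →
                 i % a ≡ j % a
  SameCycle⇒%≡ {c′ = []}     _      (() , _) _
  SameCycle⇒%≡ {c′ = x ∷ xs} assocᵢ assocⱼ   (k , rotate≡) =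
    trans (sym (AssocCycle-% assocᵢ (∈-rotate k _ (subst (x ∈_) (sym rotate≡) (here refl)))))
          (AssocCycle-% assocⱼ (here refl))

%-+-cong : ∀ {m m′ n n′} d .{{_ : NonZero d}} → m % d ≡ m′ % d → n % d ≡ n′ % d →
           (m + n) % d ≡ (m′ + n′) % d
%-+-cong {m} {m′} {n} {n′} d m≡m′ n≡n′ = begin
  (m + n) % d               ≡⟨ %-distribˡ-+ m n d ⟩
  (m % d + n % d) % d       ≡⟨ cong₂ (λ u v → (u + v) % d) m≡m′ n≡n′ ⟩
  (m′ % d + n′ % d) % d     ≡⟨ %-distribˡ-+ m′ n′ d ⟨
  (m′ + n′) % d             ∎
  where open ≡-Reasoning

m*n%d≡m%d : ∀ m {n d} .{{_ : NonZero n}} .{{_ : NonZero d}} → d ∣ n ∸ 1 → (m * n) % d ≡ m % d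
m*n%d≡m%d m {n} {d} (divides k n∸1≡kd) = begin
  m * n % d                ≡⟨ cong (λ n → m * n % d) (trans (sym (suc-pred n)) (cong suc n∸1≡kd)) ⟩
  m * (1 + k * d) % d      ≡⟨ cong (_% d) (expand m k d) ⟩
  (m + m * k * d) % d      ≡⟨ [m+kn]%n≡m%n m (m * k) d ⟩
  m % d                    ∎
  where
  open ≡-Reasoning
  expand : ∀ m k d → m * (1 + k * d) ≡ m + m * k * d
  expand = solve-∀

%-injective-[1,n] : ∀ {i j} n .{{_ : NonZero n}} → 1 ≤ i → i ≤ n → 1 ≤ j → j ≤ n →
                    i % n ≡ j % n → i ≡ j
%-injective-[1,n] n 1≤i i≤n 1≤j j≤n i%n≡j%n with m≤n⇒m<n∨m≡n i≤n | m≤n⇒m<n∨m≡n j≤n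
... | inj₁ i<n  | inj₁ j<n  = trans (sym (m<n⇒m%n≡m i<n)) (trans i%n≡j%n (m<n⇒m%n≡m j<n))
... | inj₂ refl | inj₂ refl = refl
... | inj₁ i<n  | inj₂ refl = contradiction (trans (sym (m<n⇒m%n≡m i<n)) (trans i%n≡j%n (n%n≡0 n))) (>⇒≢ 1≤i)
... | inj₂ refl | inj₁ j<n  = contradiction (trans (sym (m<n⇒m%n≡m j<n)) (trans (sym i%n≡j%n) (n%n≡0 n))) (>⇒≢ 1≤j)

module _ (b : ℕ) .{{_ : NonZero b}} (2≤b : 2 ≤ b) where

  lowDigit : ℕ → Fin b
  lowDigit n = fromℕ< (m%n<n n b)

  n/b<n : ∀ {n} → b ≤ n → n / b < n
  n/b<n {n} b≤n = m/n<m n b {{>-nonZero (≤-trans (<⇒≤ 2≤b) b≤n)}} 2≤b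

  digitsFuel-irrelevant : ∀ {fuel fuel′ n} → n < fuel → n < fuel′ →
                          digitsFuel b fuel n ≡ digitsFuel b fuel′ n
  digitsFuel-irrelevant {fuel} {fuel′} {n} _ _ with n <? b
  ... | yes _ = refl
  digitsFuel-irrelevant {suc fuel} {suc fuel′} {n} (s≤s n≤fuel) (s≤s n≤fuel′) | no n≮b =
    cong (lowDigit n ∷_) (digitsFuel-irrelevant (<-≤-trans n/b<n′ n≤fuel) (<-≤-trans n/b<n′ n≤fuel′))
    where n/b<n′ = n/b<n (≮⇒≥ n≮b)

  digit-ind : ∀ {ℓ} (P : ℕ → Set ℓ) → (∀ {n} → n < b → P n) → (∀ {n} → b ≤ n → P (n / b) → P n) →
              ∀ n → P n
  digit-ind P small step = <-rec P λ n ih → case b ≤? n of λ where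
    (yes b≤n) → step b≤n (ih (n/b<n b≤n))
    (no b≰n)  → small (≰⇒> b≰n)

  module _ (φ : Fin b → ℕ) where

    S-small : ∀ {n} (n<b : n < b) → S b φ n ≡ φ (fromℕ< n<b)
    S-small {n} n<b with n <? b
    ... | yes _   = +-identityʳ _
    ... | no n≮b = contradiction n<b n≮b

    S-step : ∀ {n} → b ≤ n → S b φ n ≡ φ (lowDigit n) + S b φ (n / b)
    S-step {n} b≤n with n <? b
    ... | yes n<b = contradiction b≤n (<⇒≱ n<b)
    ... | no _    = cong (λ ds → φ (lowDigit n) + sum (map φ ds)) (digitsFuel-irrelevant (n/b<n b≤n) ≤-refl)

    S-% : ∀ a .{{_ : NonZero a}} → a ∣ b ∸ 1 → (∀ x → φ x % a ≡ toℕ x % a) →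
          ∀ n → S b φ n % a ≡ n % a
    S-% a a∣b∸1 φ≡ = digit-ind _ small step
      where
      open ≡-Reasoning
      small : ∀ {n} → n < b → S b φ n % a ≡ n % a
      small {n} n<b = begin
        S b φ n % a                ≡⟨ cong (_% a) (S-small n<b) ⟩
        φ (fromℕ< n<b) % a         ≡⟨ φ≡ _ ⟩
        toℕ (fromℕ< n<b) % a       ≡⟨ cong (_% a) (toℕ-fromℕ< n<b) ⟩
        n % a                      ∎
      step : ∀ {n} → b ≤ n → S b φ (n / b) % a ≡ (n / b) % a → S b φ n % a ≡ n % a
      step {n} b≤n ih = begin
        S b φ n % a                          ≡⟨ cong (_% a) (S-step b≤n) ⟩
        (φ (lowDigit n) + S b φ (n / b)) % a ≡⟨ %-+-cong a (φ≡ _) ih ⟩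
        (toℕ (lowDigit n) + n / b) % a       ≡⟨ %-+-cong a (cong (_% a) (toℕ-fromℕ< (m%n<n n b)))
                                                           (sym (m*n%d≡m%d (n / b) a∣b∸1)) ⟩
        (n % b + n / b * b) % a              ≡⟨ cong (_% a) (m≡m%n+[m/n]*n n b) ⟨
        n % a                                ∎

    maxφ : ℕ
    maxφ = max 0 (tabulate φ)

    φ≤maxφ : ∀ x → φ x ≤ maxφ
    φ≤maxφ = All.tabulate⁻ (xs≤max 0 (tabulate φ))

    S≤maxφ*[1+n] : ∀ n → S b φ n ≤ maxφ * suc n
    S≤maxφ*[1+n] = digit-ind _ small step
      where
      open ≤-Reasoning
      small : ∀ {n} → n < b → S b φ n ≤ maxφ * suc n
      small {n} n<b = begin
        S b φ n  ≡⟨ S-small n<b ⟩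
        φ _      ≤⟨ φ≤maxφ _ ⟩
        maxφ     ≤⟨ m≤m*n maxφ (suc n) ⟩
        maxφ * suc n ∎
      step : ∀ {n} → b ≤ n → S b φ (n / b) ≤ maxφ * suc (n / b) → S b φ n ≤ maxφ * suc n
      step {n} b≤n ih = begin
        S b φ n                          ≡⟨ S-step b≤n ⟩
        φ (lowDigit n) + S b φ (n / b)   ≤⟨ +-mono-≤ (φ≤maxφ _) ih ⟩
        maxφ + maxφ * suc (n / b)        ≡⟨ *-suc maxφ (suc (n / b)) ⟨
        maxφ * suc (suc (n / b))         ≤⟨ *-monoʳ-≤ maxφ (s≤s (n/b<n b≤n)) ⟩
        maxφ * suc n                     ∎

    slack : ℕ
    slack = 2 * (maxφ * (4 * maxφ))

    -- Below 4 maxφ use the linear bound; above it, the extra 2 maxφ from the lowest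
    -- digit is absorbed by n − ⌊n/b⌋ ≥ n/2.
    2*S≤n+slack : ∀ n → 2 * S b φ n ≤ n + slack
    2*S≤n+slack = digit-ind _ small step
      where
      open ≤-Reasoning
      below : ∀ {n} → n < 4 * maxφ → 2 * S b φ n ≤ n + slack
      below {n} n<4maxφ = begin
        2 * S b φ n              ≤⟨ *-monoʳ-≤ 2 (S≤maxφ*[1+n] n) ⟩
        2 * (maxφ * suc n)       ≤⟨ *-monoʳ-≤ 2 (*-monoʳ-≤ maxφ n<4maxφ) ⟩
        slack                    ≤⟨ m≤n+m slack n ⟩
        n + slack                ∎
      2maxφ+n/b≤n : ∀ {n} → 4 * maxφ ≤ n → 2 * maxφ + n / b ≤ n
      2maxφ+n/b≤n {n} 4maxφ≤n = *-cancelˡ-≤ 2 (begin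
        2 * (2 * maxφ + n / b)          ≡⟨ *-distribˡ-+ 2 (2 * maxφ) (n / b) ⟩
        2 * (2 * maxφ) + 2 * (n / b)    ≡⟨ cong (_+ 2 * (n / b)) (*-assoc 2 2 maxφ) ⟨
        4 * maxφ + 2 * (n / b)          ≤⟨ +-mono-≤ 4maxφ≤n 2*[n/b]≤n ⟩
        n + n                           ≡⟨ cong (n +_) (+-identityʳ n) ⟨
        2 * n                           ∎)
        where
        2*[n/b]≤n : 2 * (n / b) ≤ n
        2*[n/b]≤n = begin
          2 * (n / b)  ≡⟨ *-comm 2 (n / b) ⟩
          n / b * 2    ≤⟨ *-monoʳ-≤ (n / b) 2≤b ⟩
          n / b * b    ≤⟨ m/n*n≤m n b ⟩
          n            ∎
      small : ∀ {n} → n < b → 2 * S b φ n ≤ n + slack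
      small {n} n<b with n <? 4 * maxφ
      ... | yes n<4maxφ = below n<4maxφ
      ... | no n≮4maxφ = begin
        2 * S b φ n              ≡⟨ cong (2 *_) (S-small n<b) ⟩
        2 * φ _                  ≤⟨ *-monoʳ-≤ 2 (φ≤maxφ _) ⟩
        2 * maxφ                 ≤⟨ m≤m+n (2 * maxφ) (n / b) ⟩
        2 * maxφ + n / b         ≤⟨ 2maxφ+n/b≤n (≮⇒≥ n≮4maxφ) ⟩
        n                        ≤⟨ m≤m+n n slack ⟩
        n + slack                ∎
      step : ∀ {n} → b ≤ n → 2 * S b φ (n / b) ≤ n / b + slack → 2 * S b φ n ≤ n + slack
      step {n} b≤n ih with n <? 4 * maxφ
      ... | yes n<4maxφ = below n<4maxφ
      ... | no n≮4maxφ = begin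
        2 * S b φ n                               ≡⟨ cong (2 *_) (S-step b≤n) ⟩
        2 * (φ (lowDigit n) + S b φ (n / b))      ≡⟨ *-distribˡ-+ 2 (φ (lowDigit n)) _ ⟩
        2 * φ (lowDigit n) + 2 * S b φ (n / b)    ≤⟨ +-mono-≤ (*-monoʳ-≤ 2 (φ≤maxφ _)) ih ⟩
        2 * maxφ + (n / b + slack)                ≡⟨ +-assoc (2 * maxφ) (n / b) slack ⟨
        2 * maxφ + n / b + slack                  ≤⟨ +-monoˡ-≤ slack (2maxφ+n/b≤n (≮⇒≥ n≮4maxφ)) ⟩
        n + slack                                 ∎

    S-≤-closed : ∀ {B m} → slack ≤ B → m ≤ B → S b φ m ≤ B
    S-≤-closed {B} {m} slack≤B m≤B = *-cancelˡ-≤ 2 (begin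
      2 * S b φ m    ≤⟨ 2*S≤n+slack m ⟩
      m + slack      ≤⟨ +-mono-≤ m≤B slack≤B ⟩
      B + B          ≡⟨ cong (B +_) (+-identityʳ B) ⟨
      2 * B          ∎)
      where open ≤-Reasoning

proposition6p2 : (b : ℕ) .{{_ : NonZero b}} → 2 ≤ b → (φ : Fin b → ℕ) →
    (a : ℕ) .{{_ : NonZero a}} → a ∣ b ∸ 1 → (∀ x → φ x % a ≡ toℕ x % a) →
    (∀ n → S b φ n % a ≡ n % a)
    × (∀ i j → 1 ≤ i → i ≤ a → 1 ≤ j → j ≤ a → i ≢ j →
        (c c' : List ℕ) → AssocCycle (S b φ) i c → AssocCycle (S b φ) j c' →
        ¬ SameCycle c c')
    × (∀ i → 1 ≤ i → i ≤ a → ∃ λ c → AssocCycle (S b φ) i c)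
proposition6p2 b 2≤b φ a a∣b∸1 φ≡ = S≡ , distinct , exists
  where
  S≡ : ∀ n → S b φ n % a ≡ n % a
  S≡ = S-% b 2≤b φ a a∣b∸1 φ≡

  distinct : ∀ i j → 1 ≤ i → i ≤ a → 1 ≤ j → j ≤ a → i ≢ j →
             (c c' : List ℕ) → AssocCycle (S b φ) i c → AssocCycle (S b φ) j c' →
             ¬ SameCycle c c'
  distinct i j 1≤i i≤a 1≤j j≤a i≢j _ _ assocᵢ assocⱼ same =
    i≢j (%-injective-[1,n] a 1≤i i≤a 1≤j j≤a (SameCycle⇒%≡ (S b φ) a S≡ assocᵢ assocⱼ same))

  exists : ∀ i → 1 ≤ i → i ≤ a → ∃ λ c → AssocCycle (S b φ) i c
  exists i _ _ = bounded⇒AssocCycle (S b φ) (i + slack b 2≤b φ) i λ k →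
    iter-≤ (S b φ) (S-≤-closed b 2≤b φ (m≤n+m _ i)) k (m≤m+n i _)
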